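{- Let $f:\{ -1,1\}^n\to\{ -1,1\}$ be computed by a decision tree $T$ with expected depth $d$. Then $\mathrm{Cov}[T]\le d$.
   Context: Expected depth is the expected number of queries on a uniformly random input, i.e. $\sum_v 2^{ -d(v)}$ over internal nodes $v$ with $d(v)$ the depth (root at 0). $\mathrm{Cov}[g,h]=\mathbb{E}[(g-\mathbb{E}g)(h-\mathbb{E}h)]$ under the uniform distribution. For an internal node $v$, $\mathrm{Cov}[v]=\mathrm{Cov}[g_v,h_v]$ where $g_v,h_v$ are the functions computed by $v$'s left ($+1$) and right ($-1$) subtrees; $\mathrm{Cov}[T]=\sum_v\mathrm{Cov}[v]2^{ -d(v)}$. -}

module Defs where

open import Data.Bool using (Bool; true; false; if_then_else_)
open import Data.Fin using (Fin)
open import Data.Nat using (ℕ; zero; suc)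
open import Data.Vec using (Vec; []; _∷_; lookup)
open import Data.Rational using (ℚ; 0ℚ; 1ℚ; ½; _+_; _*_; _-_; -_)

-- Inputs x ∈ {-1,1}^n are encoded as Vec Bool n, with true = +1, false = -1.
Input : ℕ → Set
Input n = Vec Bool n

pm : Bool → ℚ
pm true  = 1ℚ
pm false = - 1ℚ

-- Decision trees on n variables with ±1 leaves.
-- node i l r queries x_i; goes to l (left) if x_i = +1, to r (right) if x_i = -1.
data DTree (n : ℕ) : Set where
  leaf : Bool → DTree n
  node : Fin n → DTree n → DTree n → DTree n

eval : ∀ {n} → DTree n → Input n → Bool
eval (leaf b)     x = b
eval (node i l r) x = if lookup x i then eval l x else eval r x

evalℚ : ∀ {n} → DTree n → Input n → ℚ
evalℚ T x = pm (eval T x)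

E : ∀ n → (Input n → ℚ) → ℚ
E zero    f = f []
E (suc n) f = ½ * (E n (λ v → f (true ∷ v)) + E n (λ v → f (false ∷ v)))

Cov : ∀ n → (Input n → ℚ) → (Input n → ℚ) → ℚ
Cov n g h = E n (λ x → (g x - E n g) * (h x - E n h))

-- Expected depth: Σ_{internal v} 2^{-d(v)} (root has depth 0),
-- computed recursively: ed(node l r) = 1 + ½ (ed l + ed r).
expectedDepth : ∀ {n} → DTree n → ℚ
expectedDepth (leaf b)     = 0ℚ
expectedDepth (node i l r) = 1ℚ + ½ * (expectedDepth l + expectedDepth r)

-- Cov[T] = Σ_{internal v} Cov[g_v, h_v] 2^{-d(v)}, computed recursively,
-- where g_v, h_v are the functions computed by v's left/right subtrees.
CovT : ∀ {n} → DTree n → ℚ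
CovT         (leaf b)     = 0ℚ
CovT {n}     (node i l r) = Cov n (evalℚ l) (evalℚ r) + ½ * (CovT l + CovT r)

module Submission where

-- Both sides satisfy the same recursion over the tree: a leaf contributes 0,
-- and a node contributes its own term plus ½ of the values of its two
-- subtrees. At a node the expected-depth term is 1 and the covariance term is
-- Cov[g, h] for the ±1-valued functions g, h computed by the subtrees, so by
-- induction on the tree it suffices to prove Cov[g, h] ≤ 1 for ±1-valued g, h.
--
-- This is elementary probability on the uniform cube, developed below:
--   * E is a monotone linear functional with E[c] = c;
--   * Var[g] = E[g²] − (E g)² ≤ E[g²], which is E[1] = 1 when g is ±1-valued;
--   * pointwise AM–GM, uv ≤ ½(u² + v²), gives Cov[g, h] ≤ ½(Var[g] + Var[h]).

open import Defs
open import Data.Bool using (Bool; true; false)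
open import Data.Nat using (ℕ; zero; suc)
open import Data.Vec using (_∷_; [])
open import Data.Rational using (ℚ; _≤_; 0ℚ; 1ℚ; ½; _+_; _*_; _-_; -_)
open import Data.Rational.Properties
  using (≤-refl; ≤-trans; ≤-reflexive; +-mono-≤; *-monoˡ-≤-nonNeg; ≤-total;
         nonNeg*nonNeg⇒nonNeg; nonPos*nonPos⇒nonPos; nonNegative⁻¹)
open import Data.Rational.Base using (nonNegative; nonPositive)
open import Data.Rational.Solver using (module +-*-Solver)
open import Data.Sum using (inj₁; inj₂)
open import Relation.Binary.PropositionalEquality
  using (_≡_; refl; sym; trans; cong; cong₂; module ≡-Reasoning)

open +-*-Solver

≤-by-gap : ∀ p q d → 0ℚ ≤ d → q ≡ p + d → p ≤ q
≤-by-gap p q d 0≤d q≡p+d = begin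
  p       ≡⟨ solve 1 (λ x → x := x :+ con 0ℚ) refl p ⟩
  p + 0ℚ  ≤⟨ +-mono-≤ (≤-refl {p}) 0≤d ⟩
  p + d   ≡⟨ sym q≡p+d ⟩
  q       ∎
  where open Data.Rational.Properties.≤-Reasoning

square-nonNeg : ∀ x → 0ℚ ≤ x * x
square-nonNeg x with ≤-total 0ℚ x
... | inj₁ 0≤x = nonNegative⁻¹ (x * x)
      {{nonNeg*nonNeg⇒nonNeg x {{nonNegative 0≤x}} x {{nonNegative 0≤x}}}}
... | inj₂ x≤0 = nonNegative⁻¹ (x * x)
      {{nonPos*nonPos⇒nonPos x {{nonPositive x≤0}} x {{nonPositive x≤0}}}}

½*-mono : ∀ {p q} → p ≤ q → ½ * p ≤ ½ * q
½*-mono = *-monoˡ-≤-nonNeg ½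

am-gm : ∀ u v → u * v ≤ ½ * (u * u + v * v)
am-gm u v = ≤-by-gap _ _ (½ * ((u - v) * (u - v)))
  (½*-mono (square-nonNeg (u - v)))
  (solve 2 (λ u v → con ½ :* (u :* u :+ v :* v)
                    := u :* v :+ con ½ :* ((u :- v) :* (u :- v))) refl u v)

E-cong : ∀ n {f g : Input n → ℚ} → (∀ x → f x ≡ g x) → E n f ≡ E n g
E-cong zero    f≡g = f≡g []
E-cong (suc n) f≡g = cong (½ *_)
  (cong₂ _+_ (E-cong n (λ v → f≡g (true ∷ v))) (E-cong n (λ v → f≡g (false ∷ v))))

E-mono : ∀ n {f g : Input n → ℚ} → (∀ x → f x ≤ g x) → E n f ≤ E n g
E-mono zero    f≤g = f≤g []
E-mono (suc n) f≤g = ½*-mono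
  (+-mono-≤ (E-mono n (λ v → f≤g (true ∷ v))) (E-mono n (λ v → f≤g (false ∷ v))))

E-const : ∀ n c → E n (λ _ → c) ≡ c
E-const zero    c = refl
E-const (suc n) c rewrite E-const n c =
  solve 1 (λ c → con ½ :* (c :+ c) := c) refl c

E-+ : ∀ n (f g : Input n → ℚ) → E n (λ x → f x + g x) ≡ E n f + E n g
E-+ zero    f g = refl
E-+ (suc n) f g
  rewrite E-+ n (λ v → f (true ∷ v)) (λ v → g (true ∷ v))
        | E-+ n (λ v → f (false ∷ v)) (λ v → g (false ∷ v)) =
  solve 4 (λ a b c d → con ½ :* ((a :+ b) :+ (c :+ d))
                       := con ½ :* (a :+ c) :+ con ½ :* (b :+ d)) refl
    (E n (λ v → f (true ∷ v))) (E n (λ v → g (true ∷ v)))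
    (E n (λ v → f (false ∷ v))) (E n (λ v → g (false ∷ v)))

E-* : ∀ n c (f : Input n → ℚ) → E n (λ x → c * f x) ≡ c * E n f
E-* zero    c f = refl
E-* (suc n) c f
  rewrite E-* n c (λ v → f (true ∷ v)) | E-* n c (λ v → f (false ∷ v)) =
  solve 3 (λ c a b → con ½ :* (c :* a :+ c :* b) := c :* (con ½ :* (a :+ b))) refl
    c (E n (λ v → f (true ∷ v))) (E n (λ v → f (false ∷ v)))

E-affine : ∀ n c k (f : Input n → ℚ) → E n (λ x → c * f x + k) ≡ c * E n f + k
E-affine n c k f = begin
  E n (λ x → c * f x + k)              ≡⟨ E-+ n (λ x → c * f x) (λ _ → k) ⟩
  E n (λ x → c * f x) + E n (λ _ → k)  ≡⟨ cong₂ _+_ (E-* n c f) (E-const n k) ⟩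
  c * E n f + k                        ∎
  where open ≡-Reasoning

Var : ∀ n → (Input n → ℚ) → ℚ
Var n g = Cov n g g

Var-formula : ∀ n (g : Input n → ℚ) →
              Var n g ≡ E n (λ x → g x * g x) - E n g * E n g
Var-formula n g = begin
  Var n g
    ≡⟨ E-cong n expand ⟩
  E n (λ x → g x * g x + (- (a + a) * g x + a * a))
    ≡⟨ E-+ n (λ x → g x * g x) (λ x → - (a + a) * g x + a * a) ⟩
  E n (λ x → g x * g x) + E n (λ x → - (a + a) * g x + a * a)
    ≡⟨ cong (E n (λ x → g x * g x) +_) (E-affine n (- (a + a)) (a * a) g) ⟩
  E n (λ x → g x * g x) + (- (a + a) * a + a * a)
    ≡⟨ solve 2 (λ s a → s :+ ((:- (a :+ a)) :* a :+ a :* a) := s :- a :* a) refl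
         (E n (λ x → g x * g x)) a ⟩
  E n (λ x → g x * g x) - a * a
    ∎
  where
  open ≡-Reasoning
  a = E n g
  expand : ∀ x → (g x - a) * (g x - a) ≡ g x * g x + (- (a + a) * g x + a * a)
  expand x = solve 2 (λ u a → (u :- a) :* (u :- a)
                              := u :* u :+ ((:- (a :+ a)) :* u :+ a :* a)) refl (g x) a

Var≤E[g²] : ∀ n (g : Input n → ℚ) → Var n g ≤ E n (λ x → g x * g x)
Var≤E[g²] n g = ≤-by-gap _ _ (E n g * E n g) (square-nonNeg (E n g))
  (begin
    E n (λ x → g x * g x)
      ≡⟨ solve 2 (λ s a → s := (s :- a) :+ a) refl (E n (λ x → g x * g x)) (E n g * E n g) ⟩
    (E n (λ x → g x * g x) - E n g * E n g) + E n g * E n g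
      ≡⟨ cong (_+ E n g * E n g) (sym (Var-formula n g)) ⟩
    Var n g + E n g * E n g
      ∎)
  where open ≡-Reasoning

Var≤1 : ∀ n (g : Input n → ℚ) → (∀ x → g x * g x ≡ 1ℚ) → Var n g ≤ 1ℚ
Var≤1 n g g²≡1 = ≤-trans (Var≤E[g²] n g)
  (≤-reflexive (trans (E-cong n g²≡1) (E-const n 1ℚ)))

-- Cov[g, h] ≤ ½(Var[g] + Var[h]), by AM–GM applied pointwise to the
-- centred functions.
Cov≤mean-Var : ∀ n (g h : Input n → ℚ) → Cov n g h ≤ ½ * (Var n g + Var n h)
Cov≤mean-Var n g h = ≤-trans (E-mono n (λ x → am-gm (g′ x) (h′ x)))
  (≤-reflexive (begin
    E n (λ x → ½ * (g′ x * g′ x + h′ x * h′ x))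
      ≡⟨ E-* n ½ (λ x → g′ x * g′ x + h′ x * h′ x) ⟩
    ½ * E n (λ x → g′ x * g′ x + h′ x * h′ x)
      ≡⟨ cong (½ *_) (E-+ n (λ x → g′ x * g′ x) (λ x → h′ x * h′ x)) ⟩
    ½ * (Var n g + Var n h)
      ∎))
  where
  open ≡-Reasoning
  g′ h′ : Input n → ℚ
  g′ x = g x - E n g
  h′ x = h x - E n h

Cov≤1 : ∀ n (g h : Input n → ℚ) →
        (∀ x → g x * g x ≡ 1ℚ) → (∀ x → h x * h x ≡ 1ℚ) → Cov n g h ≤ 1ℚ
Cov≤1 n g h g²≡1 h²≡1 = ≤-trans (Cov≤mean-Var n g h) (begin
  ½ * (Var n g + Var n h)  ≤⟨ ½*-mono (+-mono-≤ (Var≤1 n g g²≡1) (Var≤1 n h h²≡1)) ⟩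
  ½ * (1ℚ + 1ℚ)            ≡⟨ refl ⟩
  1ℚ                       ∎)
  where open Data.Rational.Properties.≤-Reasoning

evalℚ-square : ∀ {n} (T : DTree n) x → evalℚ T x * evalℚ T x ≡ 1ℚ
evalℚ-square T x with eval T x
... | true  = refl
... | false = refl

-- Induction along the common recursion of CovT and expectedDepth; each node
-- contributes Cov[g_v, h_v] ≤ 1 against its depth term 1.
CovT≤expectedDepth : ∀ {n} (T : DTree n) → CovT T ≤ expectedDepth T
CovT≤expectedDepth     (leaf b)     = ≤-refl
CovT≤expectedDepth {n} (node i l r) = +-mono-≤
  (Cov≤1 n (evalℚ l) (evalℚ r) (evalℚ-square l) (evalℚ-square r))
  (½*-mono (+-mono-≤ (CovT≤expectedDepth l) (CovT≤expectedDepth r)))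

proposition2p2 : (n : ℕ) (f : Input n → Bool) (T : DTree n) →
    (∀ x → eval T x ≡ f x) →
    CovT T ≤ expectedDepth T
proposition2p2 n f T _ = CovT≤expectedDepth T
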